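{- For all $\beta<\alpha<\omega_1$ and $A,B\in \mathbf{K}_\alpha$, if $A\subset B$ and $\omega_\beta^A=\omega_\beta^B$, then $(\omega_{\beta+1}^B,<)$ end-extends $(\omega_{\beta+1}^A,<)$.
   Context: For $1\le\alpha<\omega_1$, $\phi_\alpha$ is the $\mathcal{L}_{\omega_1,\omega}$-sentence in the vocabulary with unary predicates $\omega_\beta$ ($\beta\le\alpha$), a binary relation $<$, ternary relations $L_\beta,S_\beta$ ($\beta<\alpha$) and 4-ary relations $T_\beta$ ($\beta<\alpha$), asserting, for each $\beta<\alpha$, $x\in\omega_{\beta+1}$, $y\in\omega_\beta$: (1) the universe is a continuously increasing union $\bigcup_{\beta\le\alpha}\omega_\beta$, strictly linearly ordered by $<$; (2) $\omega_0$ is infinite yet $\downarrow n=\{m : m<n\}$ is finite for all $n\in\omega_0$; (3) $\omega_\beta$ is $<$-downward closed; (4) $L_\beta,T_\beta,S_\beta$ are graphs of functions (write $L_\beta(x,y)$, and $L_\beta(x,\bullet)$ for $y\mapsto L_\beta(x,y)$, etc.); (5) if $\downarrow x\neq\emptyset$, $L_\beta(x,\bullet)$ is a surjection from $\omega_\beta$ onto $\downarrow x$; (6) $\mathrm{dom}(T_\beta(x,y,\bullet))={\downarrow x}$ and $T_\beta(x,y,\bullet)=^*T_\beta(x,z,\bullet)$ for each $z\in\omega_\beta$ (equality modulo a finite set); (7) for each $w<x$ there is $z\in\omega_\beta$ with $T_\beta(w,z,\bullet)\subset T_\beta(x,y,\bullet)$; (8) $S_\beta:\omega_{\beta+1}\times\omega_\beta\to\omega_\beta$;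 (9) for $w<x$ and $z\in\omega_\beta$, if $T_\beta(w,z,\bullet)\subset T_\beta(x,y,\bullet)$ then $S_\beta(w,z)\neq S_\beta(x,y)$. $\mathbf{K}_\alpha$ is the class of all models of $\phi_\alpha$ with the substructure relation $\subset$; $\omega_\beta^M$ etc. denote interpretations in $M$. -}

module Defs where

open import Data.Nat using (ℕ)
open import Data.Product using (Σ; ∃; _×_; _,_)
open import Data.Sum using (_⊎_)
open import Data.Empty using (⊥)
open import Data.List using (List)
open import Data.List.Membership.Propositional using (_∈_)
open import Relation.Nullary using (¬_)
open import Relation.Binary.PropositionalEquality using (_≡_; _≢_)
open import Relation.Binary.Structures using (IsStrictTotalOrder)
open import Induction.WellFounded using (WellFounded)

-- A countable ordinal α with 1 ≤ α < ω₁, presented as the (nonempty,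
-- countable) well-ordered set  W = { β : β < α }.

record CountableOrdinal : Set₁ where
  field
    W        : Set
    _≺_      : W → W → Set
    isSTO    : IsStrictTotalOrder _≡_ _≺_
    wf       : WellFounded _≺_
    enum     : ℕ → W                       -- countable and nonempty (α ≥ 1)
    enumSurj : ∀ w → ∃ λ n → enum n ≡ w

-- Indices β ≤ α :  below β  (β < α)  or  top  (= α).
data Idx (α : CountableOrdinal) : Set where
  below : CountableOrdinal.W α → Idx α
  top   : Idx α

module _ (α : CountableOrdinal) where
  open CountableOrdinal α

  infix 4 _<ᴵ_
  data _<ᴵ_ : Idx α → Idx α → Set where
    b<b : ∀ {β γ} → β ≺ γ → below β <ᴵ below γ
    b<t : ∀ {β} → below β <ᴵ top

  _≤ᴵ_ : Idx α → Idx α → Set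
  i ≤ᴵ j = i ≡ j ⊎ i <ᴵ j

  IsSucc : Idx α → Idx α → Set
  IsSucc β γ = (β <ᴵ γ) × (∀ δ → β <ᴵ δ → γ ≤ᴵ δ)

  IsLimit : Idx α → Set
  IsLimit λ' = (∃ λ β → β <ᴵ λ') × (¬ (∃ λ β → IsSucc β λ'))

  IsZero : Idx α → Set
  IsZero z = ∀ δ → ¬ (δ <ᴵ z)

  record Str : Set₁ where
    field
      C  : Set
      Om : Idx α → C → Set
      Lt : C → C → Set
      L  : W → C → C → C → Set
      S  : W → C → C → C → Set
      T  : W → C → C → C → C → Set

  Finite : {C : Set} → (C → Set) → Set
  Finite {C} P = ∃ λ (xs : List C) → ∀ x → P x → x ∈ xs

  Infinite : {C : Set} → (C → Set) → Set
  Infinite P = ¬ Finite P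

  record IsModel (M : Str) : Set where
    open Str M
    field
      union      : ∀ x → Om top x
      increasing : ∀ β γ x → β ≤ᴵ γ → Om β x → Om γ x
      continuous : ∀ λ' x → IsLimit λ' → Om λ' x → ∃ λ β → (β <ᴵ λ') × Om β x
      lt-irrefl  : ∀ x → ¬ Lt x x
      lt-trans   : ∀ x y z → Lt x y → Lt y z → Lt x z
      lt-tri     : ∀ x y → Lt x y ⊎ x ≡ y ⊎ Lt y x
      om0-inf    : ∀ z → IsZero z → Infinite (Om z)
      om0-fin    : ∀ z → IsZero z → ∀ n → Om z n → Finite (λ m → Lt m n)
      down       : ∀ β x y → Om β y → Lt x y → Om β x
      -- conditions (4)-(9), for β < α, γ = β+1, x ∈ ω_{β+1}, y ∈ ω_β
      -- (4) L_β, T_β, S_β are graphs of functions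
      L-fun : ∀ β γ → IsSucc (below β) γ → ∀ x y → Om γ x → Om (below β) y →
              ∀ u v → L β x y u → L β x y v → u ≡ v
      S-fun : ∀ β γ → IsSucc (below β) γ → ∀ x y → Om γ x → Om (below β) y →
              ∀ u v → S β x y u → S β x y v → u ≡ v
      T-fun : ∀ β γ → IsSucc (below β) γ → ∀ x y → Om γ x → Om (below β) y →
              ∀ z u v → T β x y z u → T β x y z v → u ≡ v
      L-tot  : ∀ β γ → IsSucc (below β) γ → ∀ x y → Om γ x → Om (below β) y →
               (∃ λ m → Lt m x) → ∃ λ u → L β x y u × Lt u x
      L-surj : ∀ β γ → IsSucc (below β) γ → ∀ x → Om γ x →
               (∃ λ m → Lt m x) →
               ∀ u → Lt u x → ∃ λ y → Om (below β) y × L β x y u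
      T-dom  : ∀ β γ → IsSucc (below β) γ → ∀ x y → Om γ x → Om (below β) y →
               ∀ z → ((∃ λ v → T β x y z v) → Lt z x) × (Lt z x → ∃ λ v → T β x y z v)
      T-eq*  : ∀ β γ → IsSucc (below β) γ → ∀ x y → Om γ x → Om (below β) y →
               ∀ y' → Om (below β) y' →
               Finite (λ z → ¬ (∀ v → (T β x y z v → T β x y' z v) × (T β x y' z v → T β x y z v)))
      T-coh  : ∀ β γ → IsSucc (below β) γ → ∀ x y → Om γ x → Om (below β) y →
               ∀ w → Lt w x → ∃ λ z → Om (below β) z × (∀ u v → T β w z u v → T β x y u v)
      S-tot  : ∀ β γ → IsSucc (below β) γ → ∀ x y → Om γ x → Om (below β) y →
               ∃ λ u → S β x y u × Om (below β) u
      S-sep  : ∀ β γ → IsSucc (below β) γ → ∀ x y → Om γ x → Om (below β) y →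
               ∀ w z → Lt w x → Om (below β) z →
               (∀ u v → T β w z u v → T β x y u v) →
               ∀ s t → S β w z s → S β x y t → s ≢ t

  -- A ⊂ B : A is (isomorphic via f to) a substructure of B.
  record Sub (A B : Str) : Set where
    module A = Str A
    module B = Str B
    field
      f     : A.C → B.C
      f-inj : ∀ a a' → f a ≡ f a' → a ≡ a'
      Om-pres : ∀ i a → (A.Om i a → B.Om i (f a)) × (B.Om i (f a) → A.Om i a)
      Lt-pres : ∀ a b → (A.Lt a b → B.Lt (f a) (f b)) × (B.Lt (f a) (f b) → A.Lt a b)
      L-pres  : ∀ β a b c → (A.L β a b c → B.L β (f a) (f b) (f c)) ×
                            (B.L β (f a) (f b) (f c) → A.L β a b c)
      S-pres  : ∀ β a b c → (A.S β a b c → B.S β (f a) (f b) (f c)) ×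
                            (B.S β (f a) (f b) (f c) → A.S β a b c)
      T-pres  : ∀ β a b c d → (A.T β a b c d → B.T β (f a) (f b) (f c) (f d)) ×
                              (B.T β (f a) (f b) (f c) (f d) → A.T β a b c d)

  SameLevel : {A B : Str} → Sub A B → Idx α → Set
  SameLevel {A} {B} e i =
    ∀ b → Str.Om B i b → ∃ λ a → Str.Om A i a × Sub.f e a ≡ b

  EndExtends : {A B : Str} → Sub A B → Idx α → Set
  EndExtends {A} {B} e i =
    (∀ a → Str.Om A i a → Str.Om B i (Sub.f e a)) ×
    (∀ a b → Str.Om A i a → Str.Om B i b → Str.Lt B b (Sub.f e a) →
       ∃ λ a' → Str.Om A i a' × Sub.f e a' ≡ b)

module Submission where

open import Defs
open import Data.Product using (∃; _×_; _,_; proj₁; proj₂)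
open import Data.Sum using (_⊎_; inj₁; inj₂)
open import Relation.Binary.PropositionalEquality using (_≡_; refl)

-- Let b < f a in ω_{β+1}^B. If a ∈ ω_β^A, then b ∈ ω_β^B = ω_β^A. Otherwise ↓a ≠ ∅, so
-- b = L_β^B(f a, y) for some y ∈ ω_β^B = ω_β^A; as L_β is a function and A ⊂ B,
-- b = f (L_β^A(a, y)) with L_β^A(a, y) < a.

module _ {α : CountableOrdinal} where

  above-or-Om : {M : Str α} → IsModel α M → ∀ i {y} x →
                Str.Om M i y → Str.Lt M y x ⊎ Str.Om M i x
  above-or-Om M i {y} x oy with IsModel.lt-tri M y x
  ... | inj₁ y<x         = inj₁ y<x
  ... | inj₂ (inj₁ refl) = inj₂ oy
  ... | inj₂ (inj₂ x<y)  = inj₂ (IsModel.down M i x y oy x<y)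

  module _ {A B : Str α} (MA : IsModel α A) (MB : IsModel α B) (e : Sub α A B) where

    open Sub e
    private
      module MA = IsModel MA
      module MB = IsModel MB

    sameLevel-downClosed : ∀ {i} → SameLevel α e i → ∀ a b →
                           A.Om i a → B.Lt b (f a) → ∃ λ a' → A.Om i a' × f a' ≡ b
    sameLevel-downClosed {i} same a b oa b<fa =
      same b (MB.down i b (f a) (proj₁ (Om-pres i a) oa) b<fa)

    L-reflects : ∀ β γ → IsSucc α (below β) γ → ∀ a y b →
                 A.Om γ a → A.Om (below β) y → (∃ λ u → A.Lt u a) →
                 B.L β (f a) (f y) b → ∃ λ u → A.Lt u a × f u ≡ b
    L-reflects β γ sc a y b oa oy ↓a≢∅ Lb
      with MA.L-tot β γ sc a y oa oy ↓a≢∅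
    ... | u , Lu , u<a =
      u , u<a ,
      MB.L-fun β γ sc (f a) (f y) (proj₁ (Om-pres γ a) oa)
               (proj₁ (Om-pres (below β) y) oy) (f u) b
               (proj₁ (L-pres β a y u) Lu) Lb

    succ-endExtends : ∀ β γ → IsSucc α (below β) γ →
                      SameLevel α e (below β) → EndExtends α e γ
    succ-endExtends β γ sc same = (λ a → proj₁ (Om-pres γ a)) , initial
      where
      Preimage : B.C → Set
      Preimage b = ∃ λ a' → A.Om γ a' × f a' ≡ b

      initial : ∀ a b → A.Om γ a → B.Om γ b → B.Lt b (f a) → Preimage b
      initial a b oa _ b<fa
        with MB.L-surj β γ sc (f a) (proj₁ (Om-pres γ a) oa) (b , b<fa) b b<fa
      ... | y , oyB , Lb with same y oyB
      ... | y' , oy' , refl with above-or-Om MA (below β) a oy'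
      ... | inj₁ y'<a = below-a (L-reflects β γ sc a y' b oa oy' (y' , y'<a) Lb)
        where
        below-a : (∃ λ u → A.Lt u a × f u ≡ b) → Preimage b
        below-a (u , u<a , fu≡b) = u , MA.down γ u a oa u<a , fu≡b
      ... | inj₂ oaβ = in-β (sameLevel-downClosed same a b oaβ b<fa)
        where
        in-β : (∃ λ a' → A.Om (below β) a' × f a' ≡ b) → Preimage b
        in-β (a' , oa' , fa'≡b) =
          a' , MA.increasing (below β) γ a' (inj₂ (proj₁ sc)) oa' , fa'≡b

mainTheorem4 : (α : CountableOrdinal) (A B : Str α) →
    IsModel α A → IsModel α B → (e : Sub α A B) →
    (β : CountableOrdinal.W α) (γ : Idx α) → IsSucc α (below β) γ →
    SameLevel α e (below β) → EndExtends α e γ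
mainTheorem4 α A B MA MB e = succ-endExtends MA MB e
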